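{- Let $G$ be a threshold graph on $\{0,1,\dots,n\}$, labeled by reverse degree sequence, with edges directed from $i$ to $j$ when $i>j$, and let $\mathbf a=(a_1,\dots,a_n)\in\mathbb Z_{>0}^n$. For a spanning tree $T$ and a vertex $i>0$, let $\delta_T^{\mathbf a}(i)=\sum_j a_j$, where $j$ ranges over the descendants of $i$ in $T$ (including $i$). Then \[\operatorname{Ehr}_{q,1}(\mathcal F_G(\mathbf a)) = \sum_{T\text{ increasing}} \prod_{i=1}^n [\delta_T^{\mathbf a}(i)]_q,\] the sum ranging over increasing spanning trees $T$ of $G$.
   Context: A threshold graph is built from one vertex by repeatedly adding a dominating vertex or an isolated vertex; labeled by reverse degree sequence means vertices $0,\dots,n$ with $d_i\ge d_j$ for $i<j$. $\mathcal F_G(\mathbf a)$ is the set of $x\in\mathbb R_{\ge0}^E$ such that for each vertex $k\ge1$ the flow out of $k$ (on edges to smaller vertices) minus the flow into $k$ equals $a_k$, and the net flow at $0$ is $-\sum a_i$. $wt_{q,t}(b)=\frac{q^b-t^b}{q-t}$ for $b>0$, $wt_{q,t}(0)=1$; for an integer flow $A=(a_{ij})$, $wt_{q,t}(A)=(-(1-t)(1-q))^{\#\{a_{ij}>0\}-n}\prod wt_{q,t}(a_{ij})$; $\operatorname{Ehr}_{q,t}(\mathcal F_G(\mathbf a))=\sum_{A\in\mathcal F_G(\mathbf a)\cap\mathbb Z^E}wt_{q,t}(A)$. Trees are rooted at $0$; $v$ is a descendant of $u$ if $u$ lies on the tree path from $0$ to $v$. An inversion of $T$ is a pair $(i,j)$,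 $i\neq0$, $i>j$, $j$ a descendant of $i$; $T$ is increasing if it has no inversions. $[k]_q=1+q+\dots+q^{k-1}$. -}

module Defs where

open import Data.Nat using (ℕ; zero; suc; _+_; _∸_; _<ᵇ_; _≡ᵇ_; _≤_; _<_)
open import Data.Fin using (Fin; zero; suc; toℕ)
open import Data.Bool using (Bool; true; false; if_then_else_; _∧_; _∨_; not)
open import Data.List using (List; []; _∷_; map; concatMap; filterᵇ; upTo; foldr; allFin)
open import Data.Product using (Σ; _×_; _,_)
open import Relation.Binary.PropositionalEquality using (_≡_)
open import Function.Bundles using (_↔_; Inverse)
open import Algebra.Bundles using (CommutativeRing)

∑ : ∀ {m} → (Fin m → ℕ) → ℕ
∑ {zero}  f = 0
∑ {suc m} f = f zero + ∑ (λ i → f (suc i))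

allF : ∀ {m} → (Fin m → Bool) → Bool
allF {zero}  f = true
allF {suc m} f = f zero ∧ allF (λ i → f (suc i))

anyF : ∀ {m} → (Fin m → Bool) → Bool
anyF {zero}  f = false
anyF {suc m} f = f zero ∨ anyF (λ i → f (suc i))

_==_ : ∀ {m} → Fin m → Fin m → Bool
i == j = toℕ i ≡ᵇ toℕ j

_<F_ : ∀ {m} → Fin m → Fin m → Bool
i <F j = toℕ i <ᵇ toℕ j

cons : ∀ {A : Set} {m} → A → (Fin m → A) → Fin (suc m) → A
cons x f zero    = x
cons x f (suc i) = f i

funs : ∀ {A : Set} (m : ℕ) → List A → List (Fin m → A)
funs zero    xs = (λ ()) ∷ []
funs (suc m) xs = concatMap (λ x → map (cons x) (funs m xs)) xs

Graph : ℕ → Set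
Graph m = Fin m → Fin m → Bool

IsSimple : ∀ {m} → Graph m → Set
IsSimple {m} G = ((i j : Fin m) → G i j ≡ G j i) × ((i : Fin m) → G i i ≡ false)

-- Graph built from vertex 0 by adding vertices 1,…,n in order; vertex k ≥ 1
-- is added as a dominating vertex (flag true) or an isolated vertex (flag false).
flag : ∀ {n} → (Fin n → Bool) → Fin (suc n) → Bool
flag s zero    = false
flag s (suc k) = s k

built : ∀ {n} → (Fin n → Bool) → Graph (suc n)
built s i j = if i <F j then flag s j else (if j <F i then flag s i else false)

IsThreshold : ∀ {n} → Graph (suc n) → Set
IsThreshold {n} G =
  Σ (Fin n → Bool) λ s → Σ (Fin (suc n) ↔ Fin (suc n)) λ σ →
    (i j : Fin (suc n)) → G i j ≡ built s (Inverse.to σ i) (Inverse.to σ j)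

deg : ∀ {m} → Graph m → Fin m → ℕ
deg G i = ∑ (λ j → if G i j then 1 else 0)

ReverseDegreeLabeled : ∀ {m} → Graph m → Set
ReverseDegreeLabeled {m} G = (i j : Fin m) → toℕ i < toℕ j → deg G j ≤ deg G i

-- A flow is a matrix A i j (flow on directed edge i → j,
-- i > j, {i,j} ∈ E(G)); entries off the edge set must be 0.
-- a : Fin n → ℕ gives a_1,…,a_n (a k is the netflow at vertex suc k).

Mat : ℕ → Set
Mat m = Fin m → Fin m → ℕ

isEdge : ∀ {m} → Graph m → Fin m → Fin m → Bool
isEdge G i j = (j <F i) ∧ G i j

outflow : ∀ {m} → Mat m → Fin m → ℕ
outflow A k = ∑ (λ j → A k j)

inflow : ∀ {m} → Mat m → Fin m → ℕ
inflow A k = ∑ (λ i → A i k)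

isFlow : ∀ {n} → Graph (suc n) → (Fin n → ℕ) → Mat (suc n) → Bool
isFlow G a A =
  allF (λ i → allF (λ j → isEdge G i j ∨ (A i j ≡ᵇ 0)))
  ∧ allF (λ k → outflow A (suc k) ≡ᵇ a k + inflow A (suc k))
  ∧ (outflow A zero + ∑ a ≡ᵇ inflow A zero)

-- All integer points of F_G(a).  Every entry of a nonnegative flow is at most
-- ∑ a, so enumerating matrices with entries in {0,…,∑ a} is exhaustive.
flows : ∀ {n} → Graph (suc n) → (Fin n → ℕ) → List (Mat (suc n))
flows {n} G a = filterᵇ (isFlow G a) (funs (suc n) (funs (suc n) (upTo (suc (∑ a)))))

npos : ∀ {m} → Mat m → ℕ
npos A = ∑ (λ i → ∑ (λ j → if 0 <ᵇ A i j then 1 else 0))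

-- Rooted spanning trees, encoded by parent maps: vertex suc k has parent par k.

Parent : ℕ → Set
Parent n = Fin n → Fin (suc n)

step : ∀ {n} → Parent n → Fin (suc n) → Fin (suc n)
step par zero    = zero
step par (suc k) = par k

iter : ∀ {A : Set} → ℕ → (A → A) → A → A
iter zero    f x = x
iter (suc k) f x = f (iter k f x)

isSpanningTree : ∀ {n} → Graph (suc n) → Parent n → Bool
isSpanningTree {n} G par =
  allF (λ k → G (suc k) (par k)) ∧ allF (λ v → iter n (step par) v == zero)

-- j is a descendant of i (i lies on the tree path from 0 to j); paths have
-- length ≤ n
isDesc : ∀ {n} → Parent n → Fin (suc n) → Fin (suc n) → Bool
isDesc {n} par i j = anyF {suc n} (λ k → iter (toℕ k) (step par) j == i)

isInversion : ∀ {n} → Parent n → Fin (suc n) → Fin (suc n) → Bool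
isInversion par i j = not (i == zero) ∧ (j <F i) ∧ isDesc par i j

isIncreasing : ∀ {n} → Parent n → Bool
isIncreasing par = not (anyF (λ i → anyF (λ j → isInversion par i j)))

increasingTrees : ∀ {n} → Graph (suc n) → List (Parent n)
increasingTrees {n} G =
  filterᵇ (λ par → isSpanningTree G par ∧ isIncreasing par) (funs n (allFin (suc n)))

δ : ∀ {n} → (Fin n → ℕ) → Parent n → Fin (suc n) → ℕ
δ a par i = ∑ (λ k → if isDesc par i (suc k) then a k else 0)

module _ {c ℓ} (R : CommutativeRing c ℓ) where
  open CommutativeRing R using (Carrier; 0#; 1#; -_; _-_) renaming (_+_ to _+R_; _*_ to _*R_)

  sumR : List Carrier → Carrier
  sumR = foldr _+R_ 0#

  ∑R : ∀ {m} → (Fin m → Carrier) → Carrier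
  ∑R {zero}  f = 0#
  ∑R {suc m} f = f zero +R ∑R (λ i → f (suc i))

  ∏R : ∀ {m} → (Fin m → Carrier) → Carrier
  ∏R {zero}  f = 1#
  ∏R {suc m} f = f zero *R ∏R (λ i → f (suc i))

  pow : Carrier → ℕ → Carrier
  pow x zero    = 1#
  pow x (suc k) = x *R pow x k

  qint : Carrier → ℕ → Carrier
  qint q k = ∑R {k} (λ i → pow q (toℕ i))

  -- wt_{q,t}(b) = (q^b - t^b)/(q - t) = ∑_{i<b} q^i t^(b-1-i) for b > 0; wt(0) = 1
  wtEntry : Carrier → Carrier → ℕ → Carrier
  wtEntry q t zero    = 1#
  wtEntry q t (suc b) = ∑R {suc b} (λ i → pow q (toℕ i) *R pow t (b ∸ toℕ i))

  wt : ∀ {n} → Carrier → Carrier → Mat (suc n) → Carrier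
  wt {n} q t A =
    pow (- ((1# - t) *R (1# - q))) (npos A ∸ n) *R ∏R (λ i → ∏R (λ j → wtEntry q t (A i j)))

  Ehr : ∀ {n} → Carrier → Carrier → Graph (suc n) → (Fin n → ℕ) → Carrier
  Ehr q t G a = sumR (map (wt q t) (flows G a))

  treeSum : ∀ {n} → Carrier → Graph (suc n) → (Fin n → ℕ) → Carrier
  treeSum {n} q G a =
    sumR (map (λ par → ∏R {n} (λ i → qint q (δ a par (suc i)))) (increasingTrees G))

{-# OPTIONS --safe #-}
module Submission where

-- At t = 1 the prefactor (-(1-t)(1-q))^(#positive entries - n) vanishes unless the flow has at most
-- n positive entries.  As every a_k > 0, each vertex k ≥ 1 has positive outflow, so such a flow has
-- exactly one positive out-edge at every k ≥ 1.  These edges go to smaller vertices, so they are the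
-- parent edges of an increasing spanning tree, and conservation (solved from the leaves down) forces
-- the flow on the edge leaving k to be δ(k).  Conversely every increasing tree carries this flow,
-- whose weight is ∏ [δ(k)]_q because wt_{q,1}(b) = [b]_q.  So the integer points of nonzero weight
-- correspond bijectively and weight-preservingly to the increasing trees.  As both sides are sums
-- over enumerated lists, of bounded matrices M and of parent maps P, the bijection is used as a
-- double count of the kernel [M is the flow of the increasing tree P].

open import Defs
open import Algebra.Bundles using (CommutativeRing)
open import Data.Bool using (Bool; true; false; T; not; _∧_; _∨_; if_then_else_)
open import Data.Bool.Properties using (T-∧; T-∨; T?; if-∧; if-float)
open import Data.Empty using (⊥-elim)
open import Data.Fin using (Fin; zero; suc; toℕ; fromℕ; fromℕ<; _>_)
open import Data.Fin.Induction using (>-wellFounded)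
import Data.Fin.Properties as Fin
open import Data.List using (List; []; _∷_; _++_; map; concatMap; filterᵇ; upTo; allFin)
open import Data.List.Properties using (map-applyUpTo; map-tabulate)
open import Data.Nat using (ℕ; zero; suc; _+_; _∸_; _≤_; _<_; z≤n; s≤s; z<s; _≡ᵇ_; _<ᵇ_; _≤?_)
import Data.Nat.Properties as ℕ
open import Data.Nat.Properties
  using (≡ᵇ⇒≡; ≡⇒≡ᵇ; <ᵇ⇒<; <⇒<ᵇ; ≤-refl; ≤-trans; ≤-total; ≤-pred; <⇒≤; <⇒≢; <⇒≱; ≰⇒>; ≤∧≢⇒<;
         <-≤-trans; 1+n≰n; m≤n⇒m≤1+n; m≤m+n; m≤n+m; +-identityʳ; +-mono-≤; +-monoˡ-≤; +-monoʳ-≤;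
         +-cancelʳ-≤; m∸n+n≡m; m∸n≡0⇒m≤n; m≤n⇒m∸n≡0; 0≢1+n; suc-injective; module ≤-Reasoning)
open import Data.Product using (∃; _×_; _,_; proj₁; proj₂)
open import Data.Sum using (_⊎_; inj₁; inj₂; map₂)
open import Function using (Equivalence; _∘_)
open import Induction.WellFounded using (Acc; acc)
open import Relation.Nullary using (¬_; yes; no)
open import Relation.Binary.PropositionalEquality
  using (_≡_; _≢_; refl; sym; trans; cong; cong₂; subst; module ≡-Reasoning)

private
  variable
    m n : ℕ
    A B : Set

∧-intro : ∀ {x y} → T x → T y → T (x ∧ y)
∧-intro p q = Equivalence.from T-∧ (p , q)

∧-elim : ∀ x {y} → T (x ∧ y) → T x × T y
∧-elim x = Equivalence.to T-∧

T-not⁺ : ∀ {x} → ¬ T x → T (not x)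
T-not⁺ {false} _  = _
T-not⁺ {true}  ¬t = ¬t _

T-not⁻ : ∀ {x} → T (not x) → ¬ T x
T-not⁻ {false} _ ()

T-ext : ∀ {x y} → (T x → T y) → (T y → T x) → x ≡ y
T-ext {false} {false} _ _ = refl
T-ext {false} {true}  _ g = ⊥-elim (g _)
T-ext {true}  {false} f _ = ⊥-elim (f _)
T-ext {true}  {true}  _ _ = refl

if-T : ∀ {a} {X : Set a} {b} {x y : X} → T b → (if b then x else y) ≡ x
if-T {b = true} _ = refl

if-¬T : ∀ {a} {X : Set a} {b} {x y : X} → ¬ T b → (if b then x else y) ≡ y
if-¬T {b = false} _  = refl
if-¬T {b = true}  ¬t = ⊥-elim (¬t _)

==⇒≡ : {i j : Fin m} → T (i == j) → i ≡ j
==⇒≡ {i = i} {j} h = Fin.toℕ-injective (≡ᵇ⇒≡ (toℕ i) (toℕ j) h)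

≡⇒== : {i j : Fin m} → i ≡ j → T (i == j)
≡⇒== {i = i} {j} i≡j = ≡⇒≡ᵇ (toℕ i) (toℕ j) (cong toℕ i≡j)

allF⁺ : (f : Fin m → Bool) → (∀ i → T (f i)) → T (allF f)
allF⁺ {zero}  f h = _
allF⁺ {suc m} f h = ∧-intro (h zero) (allF⁺ (λ i → f (suc i)) (λ i → h (suc i)))

allF⁻ : (f : Fin m → Bool) → T (allF f) → ∀ i → T (f i)
allF⁻ f h zero    = proj₁ (∧-elim (f zero) h)
allF⁻ f h (suc i) = allF⁻ (λ j → f (suc j)) (proj₂ (∧-elim (f zero) h)) i

anyF⁺ : (f : Fin m → Bool) (i : Fin m) → T (f i) → T (anyF f)
anyF⁺ f zero    h = Equivalence.from T-∨ (inj₁ h)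
anyF⁺ f (suc i) h = Equivalence.from T-∨ (inj₂ (anyF⁺ (λ j → f (suc j)) i h))

anyF⁻ : (f : Fin m → Bool) → T (anyF f) → ∃ λ i → T (f i)
anyF⁻ {suc m} f h with Equivalence.to T-∨ h
... | inj₁ h₀ = zero , h₀
... | inj₂ hₛ with anyF⁻ (λ j → f (suc j)) hₛ
...   | i , hᵢ = suc i , hᵢ

anyF-cong : {f g : Fin m → Bool} → (∀ i → f i ≡ g i) → anyF f ≡ anyF g
anyF-cong {zero}  _   = refl
anyF-cong {suc m} f≗g = cong₂ _∨_ (f≗g zero) (anyF-cong (λ i → f≗g (suc i)))

∑-cong : {f g : Fin m → ℕ} → (∀ i → f i ≡ g i) → ∑ f ≡ ∑ g
∑-cong {zero}  f≗g = refl
∑-cong {suc m} f≗g = cong₂ _+_ (f≗g zero) (∑-cong (λ i → f≗g (suc i)))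

∑-zero : {f : Fin m → ℕ} → (∀ i → f i ≡ 0) → ∑ f ≡ 0
∑-zero {zero}  f≗0 = refl
∑-zero {suc m} f≗0 = cong₂ _+_ (f≗0 zero) (∑-zero (λ i → f≗0 (suc i)))

∑-distrib-+ : (f g : Fin m → ℕ) → ∑ (λ i → f i + g i) ≡ ∑ f + ∑ g
∑-distrib-+ {zero}  f g = refl
∑-distrib-+ {suc m} f g = trans
  (cong (f zero + g zero +_) (∑-distrib-+ (λ i → f (suc i)) (λ i → g (suc i))))
  (interchange (f zero) (g zero) _ _)
  where open import Algebra.Properties.CommutativeSemigroup ℕ.+-commutativeSemigroup using (interchange)

∑-comm : ∀ {k} (h : Fin m → Fin k → ℕ) → ∑ (λ i → ∑ (h i)) ≡ ∑ (λ j → ∑ (λ i → h i j))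
∑-comm {zero}  {k} h = sym (∑-zero {k} (λ _ → refl))
∑-comm {suc m}     h = trans (cong (∑ (h zero) +_) (∑-comm (λ i → h (suc i))))
                             (sym (∑-distrib-+ (h zero) _))

∑-single : {f : Fin m → ℕ} (i : Fin m) → (∀ j → j ≢ i → f j ≡ 0) → ∑ f ≡ f i
∑-single {suc m} {f} zero    f≗0 = trans (cong (f zero +_) (∑-zero (λ j → f≗0 (suc j) λ ()))) (+-identityʳ _)
∑-single {suc m} {f} (suc i) f≗0 = trans (cong (_+ ∑ (λ j → f (suc j))) (f≗0 zero λ ()))
  (∑-single i (λ j j≢i → f≗0 (suc j) (j≢i ∘ Fin.suc-injective)))

∑-if-∧ : (b : Bool) (d : Fin m → Bool) (f : Fin m → ℕ) →
  ∑ (λ j → if b ∧ d j then f j else 0) ≡ (if b then ∑ (λ j → if d j then f j else 0) else 0)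
∑-if-∧       true  d f = refl
∑-if-∧ {m} false d f = ∑-zero {m} (λ _ → refl)

∑-indicator-unique : (g : Fin m → Bool) (b : Bool) (x : ℕ) →
  (T b → ∃ λ c → T (g c)) → (∀ c → T (g c) → T b) → (∀ {c c'} → T (g c) → T (g c') → c ≡ c') →
  ∑ (λ c → if g c then x else 0) ≡ (if b then x else 0)
∑-indicator-unique g true  x witness _ unique with witness _
... | c , gc = trans (∑-single c (λ c' c'≢c → if-¬T (λ gc' → c'≢c (unique gc' gc)))) (if-T gc)
∑-indicator-unique g false x _ sound _ = ∑-zero (λ c → if-¬T (sound c))

∑-mono-≤ : {f g : Fin m → ℕ} → (∀ i → f i ≤ g i) → ∑ f ≤ ∑ g
∑-mono-≤ {zero}  f≤g = z≤n
∑-mono-≤ {suc m} f≤g = +-mono-≤ (f≤g zero) (∑-mono-≤ (λ i → f≤g (suc i)))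

term≤∑ : (f : Fin m → ℕ) (i : Fin m) → f i ≤ ∑ f
term≤∑ f zero    = m≤m+n _ _
term≤∑ f (suc i) = ≤-trans (term≤∑ (λ j → f (suc j)) i) (m≤n+m _ (f zero))

∑-positive : (f : Fin m → ℕ) → 0 < ∑ f → ∃ λ i → 0 < f i
∑-positive {suc m} f ∑>0 with f zero in f₀≡
... | suc _ = zero , subst (0 <_) (sym f₀≡) z<s
... | zero with ∑-positive (λ i → f (suc i)) ∑>0
...   | i , fᵢ>0 = suc i , fᵢ>0

∑-ones : ∑ {m} (λ _ → 1) ≡ m
∑-ones {zero}  = refl
∑-ones {suc m} = cong suc ∑-ones

size≤∑ : (f : Fin m → ℕ) → (∀ i → 1 ≤ f i) → m ≤ ∑ f
size≤∑ f f≥1 = subst (_≤ ∑ f) ∑-ones (∑-mono-≤ f≥1)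

∑≤size⇒each≤1 : (f : Fin m → ℕ) → (∀ i → 1 ≤ f i) → ∑ f ≤ m → ∀ i → f i ≤ 1
∑≤size⇒each≤1 {suc m} f f≥1 ∑≤ zero    = +-cancelʳ-≤ m (f zero) 1
  (≤-trans (+-monoʳ-≤ (f zero) (size≤∑ (λ i → f (suc i)) (λ i → f≥1 (suc i)))) ∑≤)
∑≤size⇒each≤1 {suc m} f f≥1 ∑≤ (suc i) = ∑≤size⇒each≤1 (λ j → f (suc j)) (λ j → f≥1 (suc j))
  (≤-pred (≤-trans (+-monoˡ-≤ _ (f≥1 zero)) ∑≤)) i

-- npos A unfolds to ∑ (λ i → positives (A i)).
positives : (Fin m → ℕ) → ℕ
positives v = ∑ (λ j → if 0 <ᵇ v j then 1 else 0)

1≤positives : (v : Fin m → ℕ) {i : Fin m} → 0 < v i → 1 ≤ positives v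
1≤positives v {i} vᵢ>0 = subst (_≤ positives v) (if-T (<⇒<ᵇ vᵢ>0))
  (term≤∑ (λ j → if 0 <ᵇ v j then 1 else 0) i)

positives-head : (v : Fin (suc m) → ℕ) → 0 < v zero → positives v ≡ suc (positives (λ j → v (suc j)))
positives-head v v₀>0 = cong (_+ positives (λ j → v (suc j))) (if-T (<⇒<ᵇ v₀>0))

positives≤1⇒unique : (v : Fin m → ℕ) → positives v ≤ 1 → ∀ {i j} → 0 < v i → 0 < v j → i ≡ j
positives≤1⇒unique {suc m} v ≤1 {zero}  {zero}  _    _    = refl
positives≤1⇒unique {suc m} v ≤1 {zero}  {suc j} v₀>0 vⱼ>0 = ⊥-elim (1+n≰n
  (≤-trans (s≤s (1≤positives (λ k → v (suc k)) vⱼ>0)) (subst (_≤ 1) (positives-head v v₀>0) ≤1)))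
positives≤1⇒unique {suc m} v ≤1 {suc i} {zero}  vᵢ>0 v₀>0 = ⊥-elim (1+n≰n
  (≤-trans (s≤s (1≤positives (λ k → v (suc k)) vᵢ>0)) (subst (_≤ 1) (positives-head v v₀>0) ≤1)))
positives≤1⇒unique {suc m} v ≤1 {suc i} {suc j} vᵢ>0 vⱼ>0 =
  cong suc (positives≤1⇒unique (λ k → v (suc k)) (≤-trans (m≤n+m _ _) ≤1) vᵢ>0 vⱼ>0)

single-support⇒positives≤1 : (v : Fin m → ℕ) (i : Fin m) → (∀ j → j ≢ i → v j ≡ 0) → positives v ≤ 1
single-support⇒positives≤1 v i v≗0 = subst (_≤ 1)
  (sym (∑-single i (λ j j≢i → cong (λ x → if 0 <ᵇ x then 1 else 0) (v≗0 j j≢i))))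
  (indicator≤1 (0 <ᵇ v i))
  where
  indicator≤1 : ∀ b → (if b then 1 else 0) ≤ 1
  indicator≤1 true  = ≤-refl
  indicator≤1 false = z≤n

count : (A → Bool) → List A → ℕ
count p []       = 0
count p (x ∷ xs) = if p x then suc (count p xs) else count p xs

count-++ : (p : A → Bool) (xs ys : List A) → count p (xs ++ ys) ≡ count p xs + count p ys
count-++ p []       ys = refl
count-++ p (x ∷ xs) ys with p x
... | true  = cong suc (count-++ p xs ys)
... | false = count-++ p xs ys

count-map : (p : B → Bool) (f : A → B) (xs : List A) → count p (map f xs) ≡ count (λ x → p (f x)) xs
count-map p f []       = refl
count-map p f (x ∷ xs) with p (f x)
... | true  = cong suc (count-map p f xs)
... | false = count-map p f xs

count-none : (p : A → Bool) (xs : List A) → (∀ x → ¬ T (p x)) → count p xs ≡ 0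
count-none p []       _    = refl
count-none p (x ∷ xs) none = trans (if-¬T (none x)) (count-none p xs none)

count-∧ : (b : Bool) (p : A → Bool) (xs : List A) → count (λ x → b ∧ p x) xs ≡ (if b then count p xs else 0)
count-∧ true  p xs = refl
count-∧ false p xs = count-none _ xs (λ _ ())

pointwise : (A → A → Bool) → (Fin m → A) → (Fin m → A) → Bool
pointwise e f g = allF (λ i → e (f i) (g i))

pointwise-==⇒≡ : ∀ {k} {f g : Fin m → Fin k} → T (pointwise _==_ f g) → ∀ i → f i ≡ g i
pointwise-==⇒≡ {f = f} {g} h i = ==⇒≡ (allF⁻ (λ i → f i == g i) h i)

≡⇒pointwise-== : ∀ {k} {f g : Fin m → Fin k} → (∀ i → f i ≡ g i) → T (pointwise _==_ f g)
≡⇒pointwise-== f≗g = allF⁺ _ λ i → ≡⇒== (f≗g i)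

pointwise²-≡ᵇ⇒≡ : ∀ {k} {X Y : Fin m → Fin k → ℕ} → T (pointwise (pointwise _≡ᵇ_) X Y) → ∀ i j → X i j ≡ Y i j
pointwise²-≡ᵇ⇒≡ {X = X} {Y} h i j =
  ≡ᵇ⇒≡ _ _ (allF⁻ (λ j → X i j ≡ᵇ Y i j) (allF⁻ (λ i → pointwise _≡ᵇ_ (X i) (Y i)) h i) j)

≡⇒pointwise²-≡ᵇ : ∀ {k} {X Y : Fin m → Fin k → ℕ} → (∀ i j → X i j ≡ Y i j) → T (pointwise (pointwise _≡ᵇ_) X Y)
≡⇒pointwise²-≡ᵇ X≗Y = allF⁺ _ λ i → allF⁺ _ λ j → ≡⇒≡ᵇ _ _ (X≗Y i j)

count-funs : (e : A → A → Bool) (f : Fin m → A) (xs : List A) →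
  (∀ i → count (e (f i)) xs ≡ 1) → count (pointwise e f) (funs m xs) ≡ 1
count-funs {m = zero}  e f xs _    = refl
count-funs {A = A} {m = suc m} e f xs once = trans (count-blocks xs) (once zero)
  where
  tails : List (Fin m → A)
  tails = funs m xs
  block-count : ∀ y → count (pointwise e f) (map (cons y) tails) ≡ (if e (f zero) y then 1 else 0)
  block-count y = begin
    count (pointwise e f) (map (cons y) tails)
      ≡⟨ count-map (pointwise e f) (cons y) tails ⟩
    count (λ g → e (f zero) y ∧ pointwise e (λ i → f (suc i)) g) tails
      ≡⟨ count-∧ (e (f zero) y) _ tails ⟩
    (if e (f zero) y then count (pointwise e (λ i → f (suc i))) tails else 0)
      ≡⟨ cong (λ c → if e (f zero) y then c else 0) (count-funs e (λ i → f (suc i)) xs (λ i → once (suc i))) ⟩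
    (if e (f zero) y then 1 else 0) ∎
    where open ≡-Reasoning
  count-blocks : ∀ ys → count (pointwise e f) (concatMap (λ y → map (cons y) tails) ys) ≡ count (e (f zero)) ys
  count-blocks []       = refl
  count-blocks (y ∷ ys) = begin
    count (pointwise e f) (map (cons y) tails ++ concatMap (λ y → map (cons y) tails) ys)
      ≡⟨ count-++ (pointwise e f) (map (cons y) tails) _ ⟩
    count (pointwise e f) (map (cons y) tails) + count (pointwise e f) (concatMap (λ y → map (cons y) tails) ys)
      ≡⟨ cong₂ _+_ (block-count y) (count-blocks ys) ⟩
    (if e (f zero) y then 1 else 0) + count (e (f zero)) ys
      ≡⟨ if-float (_+ count (e (f zero)) ys) (e (f zero) y) ⟩
    count (e (f zero)) (y ∷ ys) ∎
    where open ≡-Reasoning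

count-upTo : ∀ {b S} → b < S → count (b ≡ᵇ_) (upTo S) ≡ 1
count-upTo {b} {suc S} b<S = trans (cong (count (b ≡ᵇ_)) upTo-suc) (counted b b<S)
  where
  upTo-suc : upTo (suc S) ≡ 0 ∷ map suc (upTo S)
  upTo-suc = cong (0 ∷_) (sym (map-applyUpTo (λ x → x) suc S))
  counted : ∀ b → b < suc S → count (b ≡ᵇ_) (0 ∷ map suc (upTo S)) ≡ 1
  counted zero    _         = cong suc (trans (count-map (0 ≡ᵇ_) suc (upTo S))
                                              (count-none (λ x → 0 ≡ᵇ suc x) (upTo S) (λ _ ())))
  counted (suc b) (s≤s b<S) = trans (count-map (suc b ≡ᵇ_) suc (upTo S)) (count-upTo b<S)

count-allFin : (i : Fin m) → count (i ==_) (allFin m) ≡ 1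
count-allFin {suc m} i = trans (cong (count (i ==_)) allFin-suc) (counted i)
  where
  allFin-suc : allFin (suc m) ≡ zero ∷ map suc (allFin m)
  allFin-suc = cong (zero ∷_) (sym (map-tabulate (λ x → x) suc))
  counted : (i : Fin (suc m)) → count (i ==_) (zero ∷ map suc (allFin m)) ≡ 1
  counted zero    = cong suc (trans (count-map (zero ==_) suc (allFin m))
                                    (count-none (λ x → zero == suc x) (allFin m) (λ _ ())))
  counted (suc i) = trans (count-map (suc i ==_) suc (allFin m)) (count-allFin i)

count-bounded-matrix : ∀ {k} (X : Fin m → Fin k → ℕ) {S} → (∀ i j → X i j ≤ S) →
  count (pointwise (pointwise _≡ᵇ_) X) (funs m (funs k (upTo (suc S)))) ≡ 1
count-bounded-matrix {k = k} X {S} X≤S = count-funs (pointwise _≡ᵇ_) X (funs k (upTo (suc S)))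
  λ i → count-funs _≡ᵇ_ (X i) (upTo (suc S)) λ j → count-upTo (s≤s (X≤S i j))

count-parent-maps : (p : Parent n) → count (pointwise _==_ p) (funs n (allFin (suc n))) ≡ 1
count-parent-maps p = count-funs _==_ p (allFin _) (λ k → count-allFin (p k))

-- Descendants in a parent map

iter-suc : ∀ t (f : A → A) x → iter (suc t) f x ≡ iter t f (f x)
iter-suc zero    f x = refl
iter-suc (suc t) f x = cong f (iter-suc t f x)

iter-+ : ∀ s t (f : A → A) x → iter (s + t) f x ≡ iter s f (iter t f x)
iter-+ zero    t f x = refl
iter-+ (suc s) t f x = cong f (iter-+ s t f x)

iter-cong : ∀ t {f g : A → A} → (∀ x → f x ≡ g x) → ∀ x → iter t f x ≡ iter t g x
iter-cong zero    f≗g x = refl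
iter-cong (suc t) {f} f≗g x = trans (cong f (iter-cong t f≗g x)) (f≗g _)

record Descendant (P : Parent n) (x y : Fin (suc n)) : Set where
  constructor path
  field
    length  : ℕ
    reaches : iter length (step P) y ≡ x

Descending : Parent n → Set
Descending P = ∀ k → toℕ (P k) ≤ toℕ k

Edges : Graph (suc n) → Parent n → Set
Edges G P = ∀ k → T (G (suc k) (P k))

module _ (P : Parent n) where

  isDesc⁻ : ∀ {x y} → T (isDesc P x y) → Descendant P x y
  isDesc⁻ {x} {y} h with anyF⁻ {suc n} (λ t → iter (toℕ t) (step P) y == x) h
  ... | t , iterₜ==x = path (toℕ t) (==⇒≡ iterₜ==x)

  isDesc-refl : ∀ x → T (isDesc P x x)
  isDesc-refl x = anyF⁺ {suc n} (λ t → iter (toℕ t) (step P) x == x) zero (≡⇒== {i = x} refl)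

  parent-descendant : ∀ {c y} → Descendant P (suc c) y → Descendant P (P c) y
  parent-descendant (path t iterₜ≡c) = path (suc t) (cong (step P) iterₜ≡c)

  child-on-path : ∀ {v y} → Descendant P v y → y ≢ v → ∃ λ c → P c ≡ v × Descendant P (suc c) y
  child-on-path (path t iterₜ≡v) = walk t iterₜ≡v
    where
    walk : ∀ {v y} t → iter t (step P) y ≡ v → y ≢ v → ∃ λ c → P c ≡ v × Descendant P (suc c) y
    walk zero y≡v y≢v = ⊥-elim (y≢v y≡v)
    walk {y = y} (suc t) iterₜ₊₁≡v y≢v with iter t (step P) y in iterₜ≡
    ... | suc c = c , iterₜ₊₁≡v , path t iterₜ≡
    ... | zero  = walk t (trans iterₜ≡ iterₜ₊₁≡v) y≢v

  later-ancestor : ∀ {s t x x' y} → s ≤ t → iter s (step P) y ≡ x → iter t (step P) y ≡ x' →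
    Descendant P x' x
  later-ancestor {s} {t} {y = y} s≤t iterₛ≡x iterₜ≡x' = path (t ∸ s) (begin
    iter (t ∸ s) (step P) _                    ≡⟨ cong (iter (t ∸ s) (step P)) iterₛ≡x ⟨
    iter (t ∸ s) (step P) (iter s (step P) y)  ≡⟨ iter-+ (t ∸ s) s (step P) y ⟨
    iter (t ∸ s + s) (step P) y                ≡⟨ cong (λ r → iter r (step P) y) (m∸n+n≡m s≤t) ⟩
    iter t (step P) y                          ≡⟨ iterₜ≡x' ⟩
    _ ∎)
    where open ≡-Reasoning

  ancestors-comparable : ∀ {x x' y} → Descendant P x y → Descendant P x' y →
    Descendant P x' x ⊎ Descendant P x x'
  ancestors-comparable (path s iterₛ≡x) (path t iterₜ≡x') with ≤-total s t
  ... | inj₁ s≤t = inj₁ (later-ancestor s≤t iterₛ≡x iterₜ≡x')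
  ... | inj₂ t≤s = inj₂ (later-ancestor t≤s iterₜ≡x' iterₛ≡x)

isDesc-parent : (P : Parent n) (k : Fin n) → T (isDesc P (P k) (suc k))
isDesc-parent {suc n} P k =
  anyF⁺ {suc (suc n)} (λ t → iter (toℕ t) (step P) (suc k) == P k) (suc zero) (≡⇒== {i = P k} refl)

δ-cong : (a : Fin n → ℕ) {P P' : Parent n} → (∀ k → P k ≡ P' k) → ∀ v → δ a P v ≡ δ a P' v
δ-cong {n} a {P} {P'} P≗P' v = ∑-cong λ k → cong (λ b → if b then a k else 0)
  (anyF-cong {suc n} (λ t → cong (_== v) (iter-cong (toℕ t) step-cong (suc k))))
  where
  step-cong : ∀ x → step P x ≡ step P' x
  step-cong zero    = refl
  step-cong (suc c) = P≗P' c

a≤δ : (a : Fin n → ℕ) (P : Parent n) (k : Fin n) → a k ≤ δ a P (suc k)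
a≤δ a P k = subst (_≤ δ a P (suc k)) (if-T (isDesc-refl P (suc k)))
  (term≤∑ (λ j → if isDesc P (suc k) (suc j) then a j else 0) k)

δ≤∑ : (a : Fin n → ℕ) (P : Parent n) (v : Fin (suc n)) → δ a P v ≤ ∑ a
δ≤∑ a P v = ∑-mono-≤ λ k → indicator≤ (isDesc P v (suc k))
  where
  indicator≤ : ∀ b {x} → (if b then x else 0) ≤ x
  indicator≤ true  = ≤-refl
  indicator≤ false = z≤n

module _ (P : Parent n) (desc : Descending P) where

  Descendant⇒≤ : ∀ {x y} → Descendant P x y → toℕ x ≤ toℕ y
  Descendant⇒≤ {y = y} (path t iterₜ≡x) = subst (λ z → toℕ z ≤ toℕ y) iterₜ≡x (iter-≤ t)
    where
    step-≤ : ∀ x → toℕ (step P x) ≤ toℕ x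
    step-≤ zero    = z≤n
    step-≤ (suc c) = m≤n⇒m≤1+n (desc c)
    iter-≤ : ∀ t → toℕ (iter t (step P) y) ≤ toℕ y
    iter-≤ zero    = ≤-refl
    iter-≤ (suc t) = ≤-trans (step-≤ _) (iter-≤ t)

  iter-root : ∀ t y → toℕ y ≤ t → iter t (step P) y ≡ zero
  iter-root zero    zero _   = refl
  iter-root (suc t) y    y≤t = trans (iter-suc t (step P) y) (iter-root t (step P y) (step≤t y y≤t))
    where
    step≤t : ∀ y → toℕ y ≤ suc t → toℕ (step P y) ≤ t
    step≤t zero    _         = z≤n
    step≤t (suc c) (s≤s c≤t) = ≤-trans (desc c) c≤t

  root-ancestor : ∀ y → Descendant P zero y
  root-ancestor y = path n (iter-root n y (≤-pred (Fin.toℕ<n y)))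

  isDesc⁺ : ∀ {x y} → Descendant P x y → T (isDesc P x y)
  isDesc⁺ {x} {y} (path t iterₜ≡x) with t ≤? n
  ... | yes t≤n = anyF⁺ {suc n} (λ s → iter (toℕ s) (step P) y == x) (fromℕ< (s≤s t≤n))
        (≡⇒== (trans (cong (λ r → iter r (step P) y) (Fin.toℕ-fromℕ< (s≤s t≤n))) iterₜ≡x))
  ... | no  t≰n = anyF⁺ {suc n} (λ s → iter (toℕ s) (step P) y == x) (fromℕ n)
        (≡⇒== (trans (cong (λ r → iter r (step P) y) (Fin.toℕ-fromℕ n))
                     (trans (Descendant.reaches (root-ancestor y)) (sym x≡root))))
    where
    x≡root : x ≡ zero
    x≡root = trans (sym iterₜ≡x) (iter-root t y (≤-trans (≤-pred (Fin.toℕ<n y)) (<⇒≤ (≰⇒> t≰n))))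

  child-above-parent : ∀ c → toℕ (P c) < toℕ (suc c)
  child-above-parent c = s≤s (desc c)

  parent-not-below-child : ∀ c → ¬ Descendant P (suc c) (P c)
  parent-not-below-child c below = 1+n≰n (≤-trans (Descendant⇒≤ below) (desc c))

  descendant-of-child-≢ : ∀ {c y} → Descendant P (suc c) y → y ≢ P c
  descendant-of-child-≢ {c} below y≡Pc =
    <⇒≱ (child-above-parent c) (subst (λ z → toℕ (suc c) ≤ toℕ z) y≡Pc (Descendant⇒≤ below))

  sibling-below-sibling : ∀ {c c'} → P c ≡ P c' → Descendant P (suc c') (suc c) → c ≡ c'
  sibling-below-sibling Pc≡Pc' (path zero c≡c') = Fin.suc-injective c≡c'
  sibling-below-sibling {c} {c'} Pc≡Pc' (path (suc s) iter≡c') = ⊥-elim (parent-not-below-child c'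
    (path s (trans (cong (iter s (step P)) (sym Pc≡Pc'))
                   (trans (sym (iter-suc s (step P) (suc c))) iter≡c'))))

  siblings-on-path : ∀ {c c' y} → P c ≡ P c' → Descendant P (suc c) y → Descendant P (suc c') y → c ≡ c'
  siblings-on-path Pc≡Pc' below below' with ancestors-comparable P below below'
  ... | inj₁ c'-above = sibling-below-sibling Pc≡Pc' c'-above
  ... | inj₂ c-above  = sym (sibling-below-sibling (sym Pc≡Pc') c-above)

  descendant-split : ∀ v (j : Fin n) x →
    (if isDesc P v (suc j) then x else 0) ≡
    (if suc j == v then x else 0) + ∑ (λ c → if (P c == v) ∧ isDesc P (suc c) (suc j) then x else 0)
  descendant-split v j x with suc j Fin.≟ v
  ... | yes refl = begin
    (if isDesc P (suc j) (suc j) then x else 0)  ≡⟨ if-T (isDesc-refl P (suc j)) ⟩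
    x                                            ≡⟨ +-identityʳ x ⟨
    x + 0                                        ≡⟨ cong₂ _+_ (if-T (≡⇒== {i = suc j} refl)) (∑-zero no-child) ⟨
    (if suc j == suc j then x else 0) + ∑ (λ c → if child c then x else 0) ∎
    where
    open ≡-Reasoning
    child : Fin n → Bool
    child c = (P c == suc j) ∧ isDesc P (suc c) (suc j)
    no-child : ∀ c → (if child c then x else 0) ≡ 0
    no-child c = if-¬T λ h → let (Pc==v , below) = ∧-elim (P c == suc j) h in
      descendant-of-child-≢ (isDesc⁻ P below) (sym (==⇒≡ Pc==v))
  ... | no j≢v = trans
    (sym (∑-indicator-unique child (isDesc P v (suc j)) x witness sound unique))
    (cong (_+ ∑ (λ c → if child c then x else 0)) (sym (if-¬T (j≢v ∘ ==⇒≡))))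
    where
    child : Fin n → Bool
    child c = (P c == v) ∧ isDesc P (suc c) (suc j)
    child-parent : ∀ {c} → T (child c) → P c ≡ v
    child-parent {c} h = ==⇒≡ (proj₁ (∧-elim (P c == v) h))
    child-below : ∀ {c} → T (child c) → Descendant P (suc c) (suc j)
    child-below {c} h = isDesc⁻ P (proj₂ (∧-elim (P c == v) h))
    witness : T (isDesc P v (suc j)) → ∃ λ c → T (child c)
    witness h with child-on-path P (isDesc⁻ P h) j≢v
    ... | c , Pc≡v , below = c , ∧-intro (≡⇒== Pc≡v) (isDesc⁺ below)
    sound : ∀ c → T (child c) → T (isDesc P v (suc j))
    sound c h = isDesc⁺ (subst (λ z → Descendant P z (suc j)) (child-parent h)
                               (parent-descendant P (child-below h)))
    unique : ∀ {c c'} → T (child c) → T (child c') → c ≡ c'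
    unique h h' = siblings-on-path (trans (child-parent h) (sym (child-parent h')))
                                   (child-below h) (child-below h')

  module _ (a : Fin n → ℕ) where

    δ-children : ∀ v → δ a P v ≡
      ∑ (λ j → if suc j == v then a j else 0) + ∑ (λ c → if P c == v then δ a P (suc c) else 0)
    δ-children v = begin
      δ a P v                                 ≡⟨ ∑-cong (λ j → descendant-split v j (a j)) ⟩
      ∑ (λ j → own j + ∑ (λ c → below c j))   ≡⟨ ∑-distrib-+ own (λ j → ∑ (λ c → below c j)) ⟩
      ∑ own + ∑ (λ j → ∑ (λ c → below c j))   ≡⟨ cong (∑ own +_) (∑-comm (λ j c → below c j)) ⟩
      ∑ own + ∑ (λ c → ∑ (below c))
        ≡⟨ cong (∑ own +_) (∑-cong (λ c → ∑-if-∧ (P c == v) (λ j → isDesc P (suc c) (suc j)) a)) ⟩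
      ∑ own + ∑ (λ c → if P c == v then δ a P (suc c) else 0) ∎
      where
      open ≡-Reasoning
      own : Fin n → ℕ
      own j = if suc j == v then a j else 0
      below : Fin n → Fin n → ℕ
      below c j = if (P c == v) ∧ isDesc P (suc c) (suc j) then a j else 0

    δ-suc : ∀ k → δ a P (suc k) ≡ a k + ∑ (λ c → if P c == suc k then δ a P (suc c) else 0)
    δ-suc k = trans (δ-children (suc k)) (cong (_+ ∑ (λ c → if P c == suc k then δ a P (suc c) else 0))
      (trans (∑-single k (λ j j≢k → if-¬T (j≢k ∘ Fin.suc-injective ∘ ==⇒≡)))
             (if-T (≡⇒== {i = suc k} refl))))

    δ-root : δ a P zero ≡ ∑ a
    δ-root = ∑-cong (λ j → if-T (isDesc⁺ (root-ancestor (suc j))))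

    ∑-δ-root-children : ∑ (λ c → if P c == zero then δ a P (suc c) else 0) ≡ ∑ a
    ∑-δ-root-children = begin
      children                     ≡⟨ cong (_+ children) (∑-zero {n} (λ _ → refl)) ⟨
      ∑ {n} (λ _ → 0) + children   ≡⟨ δ-children zero ⟨
      δ a P zero                   ≡⟨ δ-root ⟩
      ∑ a ∎
      where
      open ≡-Reasoning
      children : ℕ
      children = ∑ (λ c → if P c == zero then δ a P (suc c) else 0)

-- Flows of trees

record IsFlow (G : Graph (suc n)) (a : Fin n → ℕ) (A : Mat (suc n)) : Set where
  field
    support      : ∀ i j → T (isEdge G i j) ⊎ A i j ≡ 0
    conservation : ∀ k → outflow A (suc k) ≡ a k + inflow A (suc k)
    at-root      : outflow A zero + ∑ a ≡ inflow A zero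

module _ {G : Graph (suc n)} {a : Fin n → ℕ} {A : Mat (suc n)} where

  private
    supported : Fin (suc n) → Fin (suc n) → Bool
    supported i j = isEdge G i j ∨ (A i j ≡ᵇ 0)

    conserved : Fin n → Bool
    conserved k = outflow A (suc k) ≡ᵇ a k + inflow A (suc k)

  isFlow⁺ : IsFlow G a A → T (isFlow G a A)
  isFlow⁺ flow = ∧-intro (allF⁺ _ λ i → allF⁺ _ λ j → supported⁺ (support i j))
                         (∧-intro (allF⁺ _ λ k → ≡⇒≡ᵇ _ _ (conservation k)) (≡⇒≡ᵇ _ _ at-root))
    where
    open IsFlow flow
    supported⁺ : ∀ {i j} → T (isEdge G i j) ⊎ A i j ≡ 0 → T (supported i j)
    supported⁺ (inj₁ edge)  = Equivalence.from T-∨ (inj₁ edge)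
    supported⁺ (inj₂ Aᵢⱼ≡0) = Equivalence.from T-∨ (inj₂ (≡⇒≡ᵇ _ 0 Aᵢⱼ≡0))

  isFlow⁻ : T (isFlow G a A) → IsFlow G a A
  isFlow⁻ h =
    let (supports , rest)        = ∧-elim (allF (λ i → allF (supported i))) h
        (conservations , rooted) = ∧-elim (allF conserved) rest
    in record
      { support      = λ i j →
          supported⁻ (allF⁻ (supported i) (allF⁻ (λ i → allF (supported i)) supports i) j)
      ; conservation = λ k → ≡ᵇ⇒≡ _ _ (allF⁻ conserved conservations k)
      ; at-root      = ≡ᵇ⇒≡ _ _ rooted
      }
    where
    supported⁻ : ∀ {i j} → T (supported i j) → T (isEdge G i j) ⊎ A i j ≡ 0
    supported⁻ {i} {j} h with Equivalence.to T-∨ h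
    ... | inj₁ edge   = inj₁ edge
    ... | inj₂ Aᵢⱼ==0 = inj₂ (≡ᵇ⇒≡ (A i j) 0 Aᵢⱼ==0)

  IsFlow-≗ : ∀ {B : Mat (suc n)} → (∀ i j → A i j ≡ B i j) → IsFlow G a A → IsFlow G a B
  IsFlow-≗ {B} A≗B flow = record
    { support      = λ i j → map₂ (trans (sym (A≗B i j))) (support i j)
    ; conservation = λ k → trans (sym (outflow-≗ (suc k)))
                                 (trans (conservation k) (cong (a k +_) (inflow-≗ (suc k))))
    ; at-root      = trans (cong (_+ ∑ a) (sym (outflow-≗ zero))) (trans at-root (inflow-≗ zero))
    }
    where
    open IsFlow flow
    outflow-≗ : ∀ k → outflow A k ≡ outflow B k
    outflow-≗ k = ∑-cong (A≗B k)
    inflow-≗ : ∀ k → inflow A k ≡ inflow B k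
    inflow-≗ k = ∑-cong (λ i → A≗B i k)

treeFlow : (Fin n → ℕ) → Parent n → Mat (suc n)
treeFlow a P zero    j = 0
treeFlow a P (suc k) j = if P k == j then δ a P (suc k) else 0

module _ (a : Fin n → ℕ) (P : Parent n) where

  treeFlow-off-parent : ∀ k j → j ≢ P k → treeFlow a P (suc k) j ≡ 0
  treeFlow-off-parent k j j≢Pk = if-¬T (j≢Pk ∘ sym ∘ ==⇒≡)

  treeFlow-parent : ∀ k → treeFlow a P (suc k) (P k) ≡ δ a P (suc k)
  treeFlow-parent k = if-T (≡⇒== {i = P k} refl)

  treeFlow≤∑ : ∀ i j → treeFlow a P i j ≤ ∑ a
  treeFlow≤∑ zero    j = z≤n
  treeFlow≤∑ (suc k) j with P k == j
  ... | true  = δ≤∑ a P (suc k)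
  ... | false = z≤n

  treeFlow-npos : npos (treeFlow a P) ≤ n
  treeFlow-npos = begin
    npos (treeFlow a P)  ≡⟨ cong (_+ ∑ rows) (∑-zero {suc n} (λ _ → refl)) ⟩
    ∑ rows               ≤⟨ ∑-mono-≤ (λ k → single-support⇒positives≤1 _ (P k) (treeFlow-off-parent k)) ⟩
    ∑ {n} (λ _ → 1)      ≡⟨ ∑-ones ⟩
    n ∎
    where
    open ≤-Reasoning
    rows : Fin n → ℕ
    rows k = positives (treeFlow a P (suc k))

  treeFlow-isFlow : {G : Graph (suc n)} → Descending P → Edges G P → IsFlow G a (treeFlow a P)
  treeFlow-isFlow {G} desc edges = record
    { support      = support
    ; conservation = λ k → trans outflow≡δ (δ-suc P desc a k)
    ; at-root      = trans (cong (_+ ∑ a) (∑-zero {suc n} (λ _ → refl))) (sym (∑-δ-root-children P desc a))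
    }
    where
    outflow≡δ : ∀ {k} → outflow (treeFlow a P) (suc k) ≡ δ a P (suc k)
    outflow≡δ {k} = trans (∑-single (P k) (treeFlow-off-parent k)) (treeFlow-parent k)
    support : ∀ i j → T (isEdge G i j) ⊎ treeFlow a P i j ≡ 0
    support zero    j = inj₂ refl
    support (suc k) j with j Fin.≟ P k
    ... | yes refl = inj₁ (∧-intro (<⇒<ᵇ (child-above-parent P desc k)) (edges k))
    ... | no  j≢Pk = inj₂ (treeFlow-off-parent k j j≢Pk)

treeFlow-cong : (a : Fin n → ℕ) {P P' : Parent n} → (∀ k → P k ≡ P' k) →
  ∀ i j → treeFlow a P i j ≡ treeFlow a P' i j
treeFlow-cong a P≗P' zero    j = refl
treeFlow-cong a P≗P' (suc k) j =
  cong₂ (λ b x → if b then x else 0) (cong (_== j) (P≗P' k)) (δ-cong a P≗P' (suc k))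

treeFlow-injective : (a : Fin n → ℕ) → (∀ k → 0 < a k) → {P P' : Parent n} →
  (∀ i j → treeFlow a P i j ≡ treeFlow a P' i j) → ∀ k → P k ≡ P' k
treeFlow-injective a a>0 {P} {P'} same k with P k Fin.≟ P' k
... | yes Pk≡P'k = Pk≡P'k
... | no  Pk≢P'k = ⊥-elim (<⇒≢ (<-≤-trans (a>0 k) (a≤δ a P k)) (sym (begin
  δ a P (suc k)                ≡⟨ treeFlow-parent a P k ⟨
  treeFlow a P (suc k) (P k)   ≡⟨ same (suc k) (P k) ⟩
  treeFlow a P' (suc k) (P k)  ≡⟨ treeFlow-off-parent a P' k (P k) Pk≢P'k ⟩
  0 ∎)))
  where open ≡-Reasoning

module FlowWithFewPositives {G : Graph (suc n)} {a : Fin n → ℕ} (a>0 : ∀ k → 0 < a k)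
  {M : Mat (suc n)} (flow : IsFlow G a M) (few : npos M ≤ n) where

  open IsFlow flow

  row-positive : ∀ k → 0 < outflow M (suc k)
  row-positive k = subst (0 <_) (sym (conservation k)) (<-≤-trans (a>0 k) (m≤m+n _ _))

  parentOf : Parent n
  parentOf k = proj₁ (∑-positive (M (suc k)) (row-positive k))

  parentOf-positive : ∀ k → 0 < M (suc k) (parentOf k)
  parentOf-positive k = proj₂ (∑-positive (M (suc k)) (row-positive k))

  row-positives≤1 : ∀ k → positives (M (suc k)) ≤ 1
  row-positives≤1 = ∑≤size⇒each≤1 (λ k → positives (M (suc k)))
    (λ k → 1≤positives (M (suc k)) (parentOf-positive k)) (≤-trans (m≤n+m _ _) few)

  off-parent-zero : ∀ k j → j ≢ parentOf k → M (suc k) j ≡ 0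
  off-parent-zero k j j≢p with M (suc k) j in Mₖⱼ≡
  ... | zero  = refl
  ... | suc _ = ⊥-elim (j≢p (positives≤1⇒unique (M (suc k)) (row-positives≤1 k)
                               (subst (0 <_) (sym Mₖⱼ≡) z<s) (parentOf-positive k)))

  -- isEdge G zero j reduces to false: vertex 0 has no smaller neighbour.
  row-zero : ∀ j → M zero j ≡ 0
  row-zero j with support zero j
  ... | inj₂ M₀ⱼ≡0 = M₀ⱼ≡0

  parent-edge : ∀ k → T (isEdge G (suc k) (parentOf k))
  parent-edge k with support (suc k) (parentOf k)
  ... | inj₁ edge  = edge
  ... | inj₂ Mₖₚ≡0 = ⊥-elim (<⇒≢ (parentOf-positive k) (sym Mₖₚ≡0))

  parentOf-descending : Descending parentOf
  parentOf-descending k = ≤-pred (<ᵇ⇒< _ _ (proj₁ (∧-elim (parentOf k <F suc k) (parent-edge k))))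

  parentOf-edges : Edges G parentOf
  parentOf-edges k = proj₂ (∧-elim (parentOf k <F suc k) (parent-edge k))

  -- Conservation at suc k gives its out-edge in terms of the out-edges of its children, which are
  -- larger vertices; hence the induction downwards from n.
  parent-entry : ∀ k → Acc _>_ k → M (suc k) (parentOf k) ≡ δ a parentOf (suc k)
  parent-entry k (acc larger) = begin
    M (suc k) (parentOf k)   ≡⟨ ∑-single (parentOf k) (off-parent-zero k) ⟨
    outflow M (suc k)        ≡⟨ conservation k ⟩
    a k + inflow M (suc k)   ≡⟨ cong (a k +_) (cong₂ _+_ (row-zero (suc k)) (∑-cong child-entry)) ⟩
    a k + ∑ (λ c → if parentOf c == suc k then δ a parentOf (suc c) else 0)
                             ≡⟨ δ-suc parentOf parentOf-descending a k ⟨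
    δ a parentOf (suc k) ∎
    where
    open ≡-Reasoning
    child-entry : ∀ c → M (suc c) (suc k) ≡ (if parentOf c == suc k then δ a parentOf (suc c) else 0)
    child-entry c with parentOf c Fin.≟ suc k
    ... | yes pc≡k = begin
      M (suc c) (suc k)       ≡⟨ cong (M (suc c)) pc≡k ⟨
      M (suc c) (parentOf c)  ≡⟨ parent-entry c (larger c>k) ⟩
      δ a parentOf (suc c)    ≡⟨ if-T (≡⇒== pc≡k) ⟨
      _ ∎
      where
      c>k : c > k
      c>k = subst (λ v → toℕ v ≤ toℕ c) pc≡k (parentOf-descending c)
    ... | no  pc≢k = trans (off-parent-zero c (suc k) (pc≢k ∘ sym)) (sym (if-¬T (pc≢k ∘ ==⇒≡)))

  M≗treeFlow : ∀ i j → M i j ≡ treeFlow a parentOf i j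
  M≗treeFlow zero    j = row-zero j
  M≗treeFlow (suc k) j with j Fin.≟ parentOf k
  ... | yes refl = trans (parent-entry k (>-wellFounded k)) (sym (treeFlow-parent a parentOf k))
  ... | no  j≢p  = trans (off-parent-zero k j j≢p) (sym (treeFlow-off-parent a parentOf k j j≢p))

isIncreasingTree : Graph (suc n) → Parent n → Bool
isIncreasingTree G P = isSpanningTree G P ∧ isIncreasing P

parent-above⇒inversion : (P : Parent n) (k : Fin n) → toℕ (suc k) < toℕ (P k) →
  T (isInversion P (P k) (suc k))
parent-above⇒inversion P k k<Pk = ∧-intro
  (T-not⁺ λ Pk==0 → <⇒≱ k<Pk (subst (λ v → toℕ v ≤ toℕ (suc k)) (sym (==⇒≡ Pk==0)) z≤n))
  (∧-intro (<⇒<ᵇ k<Pk) (isDesc-parent P k))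

module _ (G : Graph (suc n)) (P : Parent n) where

  isIncreasingTree⁺ : Descending P → Edges G P → T (isIncreasingTree G P)
  isIncreasingTree⁺ desc edges = ∧-intro
    (∧-intro (allF⁺ _ edges) (allF⁺ _ λ v → ≡⇒== (Descendant.reaches (root-ancestor P desc v))))
    (T-not⁺ λ inversion →
      let (i , inversion-at-i) = anyF⁻ (λ i → anyF (isInversion P i)) inversion
          (j , inversion-ij)   = anyF⁻ (isInversion P i) inversion-at-i
          (j<i , j-below-i)    = ∧-elim (j <F i) (proj₂ (∧-elim (not (i == zero)) inversion-ij))
      in <⇒≱ (<ᵇ⇒< _ _ j<i) (Descendant⇒≤ P desc (isDesc⁻ P j-below-i)))

  isIncreasingTree⁻ : (∀ i → G i i ≡ false) → T (isIncreasingTree G P) → Descending P × Edges G P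
  isIncreasingTree⁻ loopless h = descending , edges
    where
    spanning : T (isSpanningTree G P)
    spanning = proj₁ (∧-elim (isSpanningTree G P) h)
    increasing : T (isIncreasing P)
    increasing = proj₂ (∧-elim (isSpanningTree G P) h)
    edges : Edges G P
    edges = allF⁻ (λ k → G (suc k) (P k)) (proj₁ (∧-elim (allF (λ k → G (suc k) (P k))) spanning))
    descending : Descending P
    descending k with toℕ (P k) ≤? toℕ k
    ... | yes Pk≤k = Pk≤k
    ... | no  Pk≰k with P k Fin.≟ suc k
    ...   | yes Pk≡k = ⊥-elim (subst T (trans (cong (G (suc k)) Pk≡k) (loopless (suc k))) (edges k))
    ...   | no  Pk≢k = ⊥-elim (T-not⁻ increasing
      (anyF⁺ (λ i → anyF (isInversion P i)) (P k) (anyF⁺ (isInversion P (P k)) (suc k)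
        (parent-above⇒inversion P k (≤∧≢⇒< (≰⇒> Pk≰k) (Pk≢k ∘ sym ∘ Fin.toℕ-injective))))))

-- Weights at t = 1 and the double count

module _ {c ℓ} (R : CommutativeRing c ℓ) where

  open CommutativeRing R
    using (_≈_; 0#; 1#; -_; _-_; setoid; ring; +-commutativeSemigroup; +-cong; +-congˡ; *-cong; *-congˡ;
           *-identityˡ; *-identityʳ; zeroˡ; -‿inverseʳ; -‿cong)
    renaming (Carrier to C; _+_ to _+ᴿ_; _*_ to _*ᴿ_; +-identityˡ to +ᴿ-identityˡ; +-identityʳ to +ᴿ-identityʳ;
              refl to ≈-refl; sym to ≈-sym; trans to ≈-trans; reflexive to ≈-reflexive)
  open import Algebra.Properties.Ring ring using (-0#≈0#)
  open import Algebra.Properties.CommutativeSemigroup +-commutativeSemigroup using (interchange)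
  open import Relation.Binary.Reasoning.Setoid setoid

  ΣL : List A → (A → C) → C
  ΣL xs f = sumR R (map f xs)

  ΣL-cong : (xs : List A) {f g : A → C} → (∀ x → f x ≈ g x) → ΣL xs f ≈ ΣL xs g
  ΣL-cong []       f≈g = ≈-refl
  ΣL-cong (x ∷ xs) f≈g = +-cong (f≈g x) (ΣL-cong xs f≈g)

  ΣL-zero : (xs : List A) {f : A → C} → (∀ x → f x ≈ 0#) → ΣL xs f ≈ 0#
  ΣL-zero []       f≈0 = ≈-refl
  ΣL-zero (x ∷ xs) f≈0 = ≈-trans (+-cong (f≈0 x) (ΣL-zero xs f≈0)) (+ᴿ-identityˡ 0#)

  ΣL-distrib-+ : (xs : List A) (f g : A → C) → ΣL xs (λ x → f x +ᴿ g x) ≈ ΣL xs f +ᴿ ΣL xs g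
  ΣL-distrib-+ []       f g = ≈-sym (+ᴿ-identityˡ 0#)
  ΣL-distrib-+ (x ∷ xs) f g = ≈-trans (+-congˡ (ΣL-distrib-+ xs f g)) (interchange (f x) (g x) _ _)

  ΣL-comm : (xs : List A) (ys : List B) (h : A → B → C) →
    ΣL xs (λ x → ΣL ys (h x)) ≈ ΣL ys (λ y → ΣL xs (λ x → h x y))
  ΣL-comm []       ys h = ≈-sym (ΣL-zero ys (λ _ → ≈-refl))
  ΣL-comm (x ∷ xs) ys h = ≈-trans (+-congˡ (ΣL-comm xs ys h)) (≈-sym (ΣL-distrib-+ ys (h x) _))

  ΣL-filter : (p : A → Bool) (f : A → C) (xs : List A) →
    sumR R (map f (filterᵇ p xs)) ≈ ΣL xs (λ x → if p x then f x else 0#)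
  ΣL-filter p f []       = ≈-refl
  ΣL-filter p f (x ∷ xs) with p x
  ... | true  = +-congˡ (ΣL-filter p f xs)
  ... | false = ≈-trans (ΣL-filter p f xs) (≈-sym (+ᴿ-identityˡ _))

  ΣL-count-0 : (p : A → Bool) (xs : List A) {f : A → C} → count p xs ≡ 0 →
    ΣL xs (λ x → if p x then f x else 0#) ≈ 0#
  ΣL-count-0 p []       _    = ≈-refl
  ΣL-count-0 p (x ∷ xs) none with T? (p x)
  ... | yes px  = ⊥-elim (0≢1+n (trans (sym none) (if-T px)))
  ... | no  ¬px = ≈-trans (+-cong (≈-reflexive (if-¬T ¬px)) (ΣL-count-0 p xs (trans (sym (if-¬T ¬px)) none)))
                          (+ᴿ-identityˡ 0#)

  ΣL-count-1 : (p : A → Bool) (xs : List A) {f : A → C} {z : C} → count p xs ≡ 1 →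
    (∀ x → T (p x) → f x ≈ z) → ΣL xs (λ x → if p x then f x else 0#) ≈ z
  ΣL-count-1 p (x ∷ xs) once f≈z with T? (p x)
  ... | yes px  = ≈-trans (+-cong (≈-trans (≈-reflexive (if-T px)) (f≈z x px))
                                  (ΣL-count-0 p xs (suc-injective (trans (sym (if-T px)) once))))
                          (+ᴿ-identityʳ _)
  ... | no  ¬px = ≈-trans
    (+-cong (≈-reflexive (if-¬T ¬px)) (ΣL-count-1 p xs (trans (sym (if-¬T ¬px)) once) f≈z))
    (+ᴿ-identityˡ _)

  ∏R-cong : {f g : Fin m → C} → (∀ i → f i ≈ g i) → ∏R R f ≈ ∏R R g
  ∏R-cong {zero}  f≈g = ≈-refl
  ∏R-cong {suc m} f≈g = *-cong (f≈g zero) (∏R-cong (λ i → f≈g (suc i)))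

  ∏R-ones : {f : Fin m → C} → (∀ i → f i ≈ 1#) → ∏R R f ≈ 1#
  ∏R-ones {zero}  f≈1 = ≈-refl
  ∏R-ones {suc m} f≈1 = ≈-trans (*-cong (f≈1 zero) (∏R-ones (λ i → f≈1 (suc i)))) (*-identityˡ 1#)

  ∏R-single : {f : Fin m → C} (i : Fin m) → (∀ j → j ≢ i → f j ≈ 1#) → ∏R R f ≈ f i
  ∏R-single {suc m} zero    f≈1 = ≈-trans (*-congˡ (∏R-ones (λ j → f≈1 (suc j) λ ()))) (*-identityʳ _)
  ∏R-single {suc m} (suc i) f≈1 = ≈-trans
    (*-cong (f≈1 zero λ ()) (∏R-single i (λ j j≢i → f≈1 (suc j) (j≢i ∘ Fin.suc-injective))))
    (*-identityˡ _)

  ∑R-cong : {f g : Fin m → C} → (∀ i → f i ≈ g i) → ∑R R f ≈ ∑R R g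
  ∑R-cong {zero}  f≈g = ≈-refl
  ∑R-cong {suc m} f≈g = +-cong (f≈g zero) (∑R-cong (λ i → f≈g (suc i)))

  pow-1# : ∀ k → pow R 1# k ≈ 1#
  pow-1# zero    = ≈-refl
  pow-1# (suc k) = ≈-trans (*-identityˡ _) (pow-1# k)

  wtEntry-at-1 : ∀ q b → 0 < b → wtEntry R q 1# b ≈ qint R q b
  wtEntry-at-1 q (suc b) _ =
    ∑R-cong {suc b} {g = λ i → pow R q (toℕ i)} (λ i → ≈-trans (*-congˡ (pow-1# (b ∸ toℕ i))) (*-identityʳ _))

  module _ {n : ℕ} (q : C) where

    prefactor≈0 : - ((1# - 1#) *ᴿ (1# - q)) ≈ 0#
    prefactor≈0 = ≈-trans (-‿cong (≈-trans (*-cong (-‿inverseʳ 1#) ≈-refl) (zeroˡ _))) -0#≈0#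

    wt-many-positives : (A : Mat (suc n)) → n < npos A → wt R q 1# A ≈ 0#
    wt-many-positives A n<npos with npos A ∸ n in excess
    ... | zero  = ⊥-elim (<⇒≱ n<npos (m∸n≡0⇒m≤n excess))
    ... | suc _ = ≈-trans (*-cong (≈-trans (*-cong prefactor≈0 ≈-refl) (zeroˡ _)) ≈-refl) (zeroˡ _)

    wt-≗ : {A B : Mat (suc n)} → (∀ i j → A i j ≡ B i j) → wt R q 1# A ≈ wt R q 1# B
    wt-≗ {A} {B} A≗B = *-cong (≈-reflexive (cong (λ k → pow R (- ((1# - 1#) *ᴿ (1# - q))) (k ∸ n)) npos-≗))
                              (∏R-cong λ i → ∏R-cong λ j → ≈-reflexive (cong (wtEntry R q 1#) (A≗B i j)))
      where
      npos-≗ : npos A ≡ npos B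
      npos-≗ = ∑-cong λ i → ∑-cong λ j → cong (λ x → if 0 <ᵇ x then 1 else 0) (A≗B i j)

    treeWeight : (Fin n → ℕ) → Parent n → C
    treeWeight a P = ∏R R (λ k → qint R q (δ a P (suc k)))

    treeWeight-cong : (a : Fin n → ℕ) {P P' : Parent n} → (∀ k → P k ≡ P' k) → treeWeight a P ≈ treeWeight a P'
    treeWeight-cong a P≗P' = ∏R-cong λ k → ≈-reflexive (cong (qint R q) (δ-cong a P≗P' (suc k)))

    wt-treeFlow : (a : Fin n → ℕ) → (∀ k → 0 < a k) → (P : Parent n) → wt R q 1# (treeFlow a P) ≈ treeWeight a P
    wt-treeFlow a a>0 P = begin
      wt R q 1# (treeFlow a P)
        ≈⟨ *-cong (≈-reflexive (cong (pow R _) (m≤n⇒m∸n≡0 (treeFlow-npos a P)))) ≈-refl ⟩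
      1# *ᴿ (∏R R {suc n} (λ j → wtEntry R q 1# 0) *ᴿ ∏R R (λ k → ∏R R (wtEntry R q 1# ∘ treeFlow a P (suc k))))
        ≈⟨ *-identityˡ _ ⟩
      ∏R R {suc n} (λ j → 1#) *ᴿ ∏R R (λ k → ∏R R (wtEntry R q 1# ∘ treeFlow a P (suc k)))
        ≈⟨ *-cong (∏R-ones {suc n} (λ _ → ≈-refl)) (∏R-cong row) ⟩
      1# *ᴿ treeWeight a P
        ≈⟨ *-identityˡ _ ⟩
      treeWeight a P ∎
      where
      row : ∀ k → ∏R R (wtEntry R q 1# ∘ treeFlow a P (suc k)) ≈ qint R q (δ a P (suc k))
      row k = begin
        ∏R R (wtEntry R q 1# ∘ treeFlow a P (suc k))
          ≈⟨ ∏R-single (P k) (λ j j≢Pk → ≈-reflexive (cong (wtEntry R q 1#) (treeFlow-off-parent a P k j j≢Pk))) ⟩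
        wtEntry R q 1# (treeFlow a P (suc k) (P k))
          ≡⟨ cong (wtEntry R q 1#) (treeFlow-parent a P k) ⟩
        wtEntry R q 1# (δ a P (suc k))
          ≈⟨ wtEntry-at-1 q _ (<-≤-trans (a>0 k) (a≤δ a P k)) ⟩
        qint R q (δ a P (suc k)) ∎

  module DoubleCounting {n : ℕ} (G : Graph (suc n)) (loopless : ∀ i → G i i ≡ false)
    (a : Fin n → ℕ) (a>0 : ∀ k → 0 < a k) (q : C) where

    matrices : List (Mat (suc n))
    matrices = funs (suc n) (funs (suc n) (upTo (suc (∑ a))))

    parents : List (Parent n)
    parents = funs n (allFin (suc n))

    sameMatrix : Mat (suc n) → Mat (suc n) → Bool
    sameMatrix = pointwise (pointwise _≡ᵇ_)

    sameParent : Parent n → Parent n → Bool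
    sameParent = pointwise _==_

    kernel : Mat (suc n) → Parent n → C
    kernel M P = if isIncreasingTree G P ∧ sameMatrix (treeFlow a P) M then treeWeight q a P else 0#

    kernel-support : ∀ M P → T (isIncreasingTree G P ∧ sameMatrix (treeFlow a P) M) → IsFlow G a M × npos M ≤ n
    kernel-support M P h =
      IsFlow-≗ same (treeFlow-isFlow a P desc edges) , subst (_≤ n) npos-≗ (treeFlow-npos a P)
      where
      increasing-tree : T (isIncreasingTree G P)
      increasing-tree = proj₁ (∧-elim (isIncreasingTree G P) h)
      desc : Descending P
      desc = proj₁ (isIncreasingTree⁻ G P loopless increasing-tree)
      edges : Edges G P
      edges = proj₂ (isIncreasingTree⁻ G P loopless increasing-tree)
      same : ∀ i j → treeFlow a P i j ≡ M i j
      same = pointwise²-≡ᵇ⇒≡ {X = treeFlow a P} {M} (proj₂ (∧-elim (isIncreasingTree G P) h))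
      npos-≗ : npos (treeFlow a P) ≡ npos M
      npos-≗ = ∑-cong λ i → ∑-cong λ j → cong (λ x → if 0 <ᵇ x then 1 else 0) (same i j)

    no-kernel : ∀ {M} → ¬ (IsFlow G a M × npos M ≤ n) → ΣL parents (kernel M) ≈ 0#
    no-kernel {M} ¬support = ΣL-zero parents λ P → ≈-reflexive (if-¬T (¬support ∘ kernel-support M P))

    kernel-column-sum : ∀ P →
      ΣL matrices (λ M → kernel M P) ≈ (if isIncreasingTree G P then treeWeight q a P else 0#)
    kernel-column-sum P with T? (isIncreasingTree G P)
    ... | yes inc = begin
      ΣL matrices (λ M → kernel M P)
        ≈⟨ ΣL-cong matrices (λ M → ≈-reflexive (trans (if-∧ (isIncreasingTree G P)) (if-T inc))) ⟩
      ΣL matrices (λ M → if sameMatrix (treeFlow a P) M then treeWeight q a P else 0#)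
        ≈⟨ ΣL-count-1 (sameMatrix (treeFlow a P)) matrices (count-bounded-matrix (treeFlow a P) (treeFlow≤∑ a P))
                      (λ _ _ → ≈-refl) ⟩
      treeWeight q a P
        ≡⟨ if-T inc ⟨
      (if isIncreasingTree G P then treeWeight q a P else 0#) ∎
    ... | no ¬inc = ≈-trans
      (ΣL-zero matrices λ M → ≈-reflexive (if-¬T (¬inc ∘ proj₁ ∘ ∧-elim (isIncreasingTree G P))))
      (≈-reflexive (sym (if-¬T ¬inc)))

    module _ {M : Mat (suc n)} (flow : IsFlow G a M) (few : npos M ≤ n) where
      open FlowWithFewPositives a>0 flow few

      kernel-condition : ∀ P → sameParent parentOf P ≡ isIncreasingTree G P ∧ sameMatrix (treeFlow a P) M
      kernel-condition P = T-ext to from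
        where
        to : T (sameParent parentOf P) → T (isIncreasingTree G P ∧ sameMatrix (treeFlow a P) M)
        to same = ∧-intro (isIncreasingTree⁺ G P desc edges)
                          (≡⇒pointwise²-≡ᵇ λ i j → trans (treeFlow-cong a (sym ∘ p≗P) i j) (sym (M≗treeFlow i j)))
          where
          p≗P : ∀ k → parentOf k ≡ P k
          p≗P = pointwise-==⇒≡ {f = parentOf} {P} same
          desc : Descending P
          desc k = subst (λ v → toℕ v ≤ toℕ k) (p≗P k) (parentOf-descending k)
          edges : Edges G P
          edges k = subst (λ v → T (G (suc k) v)) (p≗P k) (parentOf-edges k)
        from : T (isIncreasingTree G P ∧ sameMatrix (treeFlow a P) M) → T (sameParent parentOf P)
        from h = ≡⇒pointwise-== (treeFlow-injective a a>0 λ i j → trans (sym (M≗treeFlow i j)) (sym (same i j)))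
          where
          same : ∀ i j → treeFlow a P i j ≡ M i j
          same = pointwise²-≡ᵇ⇒≡ {X = treeFlow a P} {M} (proj₂ (∧-elim (isIncreasingTree G P) h))

    kernel-row-sum : ∀ M → (if isFlow G a M then wt R q 1# M else 0#) ≈ ΣL parents (kernel M)
    kernel-row-sum M with T? (isFlow G a M) | npos M ≤? n
    ... | no ¬flow | _        = ≈-trans (≈-reflexive (if-¬T ¬flow))
                                        (≈-sym (no-kernel {M} (¬flow ∘ isFlow⁺ {G = G} {a} {M} ∘ proj₁)))
    ... | yes flow | no  many = ≈-trans (≈-reflexive (if-T flow)) (≈-trans
      (wt-many-positives q M (≰⇒> many)) (≈-sym (no-kernel {M} (many ∘ proj₂))))
    ... | yes flow | yes few  = begin
      (if isFlow G a M then wt R q 1# M else 0#)  ≡⟨ if-T flow ⟩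
      wt R q 1# M                                 ≈⟨ wt-≗ q M≗treeFlow ⟩
      wt R q 1# (treeFlow a parentOf)             ≈⟨ wt-treeFlow q a a>0 parentOf ⟩
      treeWeight q a parentOf
        ≈⟨ ΣL-count-1 (sameParent parentOf) parents (count-parent-maps parentOf)
                      (λ P same → treeWeight-cong q a (sym ∘ pointwise-==⇒≡ {f = parentOf} {P} same)) ⟨
      ΣL parents (λ P → if sameParent parentOf P then treeWeight q a P else 0#)
        ≈⟨ ΣL-cong parents (λ P → ≈-reflexive (cong (λ b → if b then treeWeight q a P else 0#)
                                                     (kernel-condition flow-M few P))) ⟩
      ΣL parents (kernel M) ∎
      where
      flow-M : IsFlow G a M
      flow-M = isFlow⁻ {G = G} {a} {M} flow
      open FlowWithFewPositives a>0 flow-M few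

    Ehr≈treeSum : Ehr R q 1# G a ≈ treeSum R q G a
    Ehr≈treeSum = begin
      Ehr R q 1# G a
        ≈⟨ ΣL-filter (isFlow G a) (wt R q 1#) matrices ⟩
      ΣL matrices (λ M → if isFlow G a M then wt R q 1# M else 0#)
        ≈⟨ ΣL-cong matrices kernel-row-sum ⟩
      ΣL matrices (λ M → ΣL parents (kernel M))
        ≈⟨ ΣL-comm matrices parents kernel ⟩
      ΣL parents (λ P → ΣL matrices (λ M → kernel M P))
        ≈⟨ ΣL-cong parents kernel-column-sum ⟩
      ΣL parents (λ P → if isIncreasingTree G P then treeWeight q a P else 0#)
        ≈⟨ ΣL-filter (isIncreasingTree G) (treeWeight q a) parents ⟨
      treeSum R q G a ∎

proposition3p10 : ∀ {c ℓ} (R : CommutativeRing c ℓ) (n : ℕ) (G : Graph (suc n)) →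
    IsSimple G → IsThreshold G → ReverseDegreeLabeled G →
    (a : Fin n → ℕ) → ((i : Fin n) → 0 < a i) →
    (q : CommutativeRing.Carrier R) →
    CommutativeRing._≈_ R (Ehr R q (CommutativeRing.1# R) G a) (treeSum R q G a)
proposition3p10 R n G (_ , loopless) _ _ a a>0 q = DoubleCounting.Ehr≈treeSum R G loopless a a>0 q
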